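{- Let $G$ and $H$ be connected graphs and let $f:V(G)\to V(H)$ be any non-constant function. Then $$\sum_{u,v} d_H(f(u),f(v))^2 d_u d_v\ \le\ \frac{\mathrm{vol}(G)^2 D_H^2}{2}\left(1-\frac{1}{|V(H)|}\right),$$ where the sum is over unordered pairs $\{u,v\}$ of vertices of $G$.
   Context: Graphs are finite and simple; $d_u$ is the degree of $u$ in $G$, $\mathrm{vol}(G)=\sum_{u\in V(G)}d_u$, $d_H$ is the shortest-path distance in $H$, and $D_H$ is the diameter of $H$. -}

module Defs where

open import Data.Bool using (Bool; true; false; _∨_; _∧_; if_then_else_)
open import Data.Nat using (ℕ; zero; suc; _+_; _*_; _⊔_; _<ᵇ_)
open import Data.Fin using (Fin; toℕ)
open import Data.Fin.Properties using (_≟_)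
open import Data.List using (List; map; allFin; foldr)
open import Data.Nat.ListAction using (sum)
open import Data.Bool.ListAction using (any)
open import Data.Product using (∃; ∃-syntax; _×_)
open import Relation.Nullary.Decidable using (⌊_⌋)
open import Relation.Binary.PropositionalEquality using (_≡_)

record Graph : Set where
  field
    n      : ℕ
    adj    : Fin n → Fin n → Bool
    sym    : ∀ u v → adj u v ≡ adj v u
    irrefl : ∀ u → adj u u ≡ false
open Graph public

V : Graph → Set
V G = Fin (n G)

Σv : (G : Graph) → (V G → ℕ) → ℕ
Σv G f = sum (map f (allFin (n G)))

deg : (G : Graph) → V G → ℕ
deg G u = Σv G (λ v → if adj G u v then 1 else 0)

vol : Graph → ℕ
vol G = Σv G (deg G)

data Walk (G : Graph) : V G → V G → ℕ → Set where
  here : ∀ u → Walk G u u 0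
  step : ∀ {u w v k} → adj G u w ≡ true → Walk G w v k → Walk G u v (suc k)

Connected : Graph → Set
Connected G = ∀ (u v : V G) → ∃[ k ] Walk G u v k

reach : (G : Graph) → ℕ → V G → V G → Bool
reach G zero    u v = ⌊ u ≟ v ⌋
reach G (suc k) u v = reach G k u v ∨ any (λ w → adj G u w ∧ reach G k w v) (allFin (n G))

firstReach : (G : Graph) → V G → V G → ℕ → ℕ → ℕ
firstReach G u v start zero       = start
firstReach G u v start (suc fuel) =
  if reach G start u v then start else firstReach G u v (suc start) fuel

-- shortest-path distance d_G(u,v) (in a connected graph a shortest walk has
-- length < n, so the search up to n is exhaustive)
dist : (G : Graph) → V G → V G → ℕ
dist G u v = firstReach G u v 0 (n G)

diam : Graph → ℕ
diam G = foldr _⊔_ 0 (map (λ u → foldr _⊔_ 0 (map (λ v → dist G u v) (allFin (n G)))) (allFin (n G)))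

ΣPairs : (G : Graph) → (V G → V G → ℕ) → ℕ
ΣPairs G f = Σv G (λ u → Σv G (λ v → if toℕ u <ᵇ toℕ v then f u v else 0))

NonConstant : {A B : Set} → (A → B) → Set
NonConstant {A} f = ∃[ u ] ∃[ v ] (f u ≡ f v → Data.Empty.⊥)
  where import Data.Empty

module Submission where

-- Where f u = f v the term vanishes, elsewhere it is at most D_H² d_u d_v, so twice the pair sum is at
-- most D_H² times the separated mass Σ_{f u ≠ f v} d_u d_v = vol(G)² − Σ_x w_x², where w_x is the degree
-- mass of the fibre f⁻¹(x). Cauchy–Schwarz gives vol(G)² = (Σ_x w_x)² ≤ |V(H)| Σ_x w_x², which is the
-- factor 1 − 1/|V(H)|.

open import Defs hiding (sym)
open import Data.Nat using (ℕ; zero; suc; _+_; _*_; _∸_; _^_; _≤_; _<ᵇ_; _⊔_; z≤n)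
open import Data.Nat.Properties hiding (_≟_)
open import Data.Nat.Solver using (module +-*-Solver)
open import Data.Fin using (Fin; toℕ; zero; suc)
open import Data.Fin.Properties using (_≟_)
open import Data.Bool using (Bool; true; false; not; if_then_else_; T)
open import Data.List using (List; _∷_; map; allFin; foldr; tabulate)
open import Data.List.Properties using (map-tabulate)
open import Data.List.Membership.Propositional using (_∈_)
open import Data.List.Membership.Propositional.Properties using (∈-allFin)
open import Data.List.Relation.Unary.Any using (here; there)
import Data.Nat.ListAction as List
open import Data.Sum using ([_,_]′)
open import Function using (_∘_)
open import Relation.Nullary using (yes; no; does; contradiction)
open import Relation.Nullary.Decidable using (isYes≗does; dec-true)
open import Relation.Binary.PropositionalEquality
open import Algebra.Properties.Semiring.Sum +-*-semiring
  using (sum; sum-syntax; sum-cong-≗; sum-replicate-zero; ∑-comm; ∑-distrib-+; *-distribˡ-sum; *-distribʳ-sum)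
open import Algebra.Properties.CommutativeSemigroup *-commutativeSemigroup using (x∙yz≈y∙xz; xy∙z≈y∙xz)
open +-*-Solver using (solve; _:+_; _:*_; _:=_; con)

∑-mono-≤ : ∀ {n} {f g : Fin n → ℕ} → (∀ i → f i ≤ g i) → sum f ≤ sum g
∑-mono-≤ {zero}  f≤g = z≤n
∑-mono-≤ {suc n} f≤g = +-mono-≤ (f≤g zero) (∑-mono-≤ (f≤g ∘ suc))

∑-const : ∀ n c → ∑[ i < n ] c ≡ n * c
∑-const zero    c = refl
∑-const (suc n) c = cong (c +_) (∑-const n c)

∑∑-distrib-+ : ∀ {m n} (f g : Fin m → Fin n → ℕ) →
  ∑[ i < m ] ∑[ j < n ] (f i j + g i j) ≡ ∑[ i < m ] ∑[ j < n ] f i j + ∑[ i < m ] ∑[ j < n ] g i j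
∑∑-distrib-+ {m} f g = trans (sum-cong-≗ {m} (λ i → ∑-distrib-+ (f i) (g i))) (∑-distrib-+ {m} _ _)

*-distribˡ-∑∑ : ∀ {m n} c (f : Fin m → Fin n → ℕ) →
  c * ∑[ i < m ] ∑[ j < n ] f i j ≡ ∑[ i < m ] ∑[ j < n ] (c * f i j)
*-distribˡ-∑∑ {m} c f = trans (*-distribˡ-sum {m} c _) (sum-cong-≗ {m} (λ i → *-distribˡ-sum c (f i)))

sum*sum≡∑∑* : ∀ {m n} (f : Fin m → ℕ) (g : Fin n → ℕ) → sum f * sum g ≡ ∑[ i < m ] ∑[ j < n ] (f i * g j)
sum*sum≡∑∑* {m} f g = trans (*-distribʳ-sum (sum g) f) (sum-cong-≗ {m} (λ i → *-distribˡ-sum (f i) g))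

𝟙 : Bool → ℕ
𝟙 true  = 1
𝟙 false = 0

𝟙+𝟙-not : ∀ b → 𝟙 b + 𝟙 (not b) ≡ 1
𝟙+𝟙-not true  = refl
𝟙+𝟙-not false = refl

δ : ∀ {n} → Fin n → Fin n → ℕ
δ a b = 𝟙 (does (a ≟ b))

does-≟-sym : ∀ {n} (a b : Fin n) → does (a ≟ b) ≡ does (b ≟ a)
does-≟-sym a b with a ≟ b | b ≟ a
... | yes _  | yes _  = refl
... | no  _  | no  _  = refl
... | yes p  | no ¬q  = contradiction (sym p) ¬q
... | no  ¬p | yes q  = contradiction (sym q) ¬p

δ-sym : ∀ {n} (a b : Fin n) → δ a b ≡ δ b a
δ-sym a b = cong 𝟙 (does-≟-sym a b)

∑-δ : ∀ {n} (y : Fin n) (g : Fin n → ℕ) → ∑[ x < n ] (δ y x * g x) ≡ g y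
∑-δ {suc n} zero    g = begin
  1 * g zero + ∑[ x < n ] 0 ≡⟨ cong (1 * g zero +_) (sum-replicate-zero n) ⟩
  1 * g zero + 0            ≡⟨ +-identityʳ _ ⟩
  1 * g zero                ≡⟨ *-identityˡ _ ⟩
  g zero                    ∎
  where open ≡-Reasoning
∑-δ {suc n} (suc y) g = ∑-δ y (g ∘ suc)

2*m*n≤m*m+n*n : ∀ m n → 2 * (m * n) ≤ m * m + n * n
2*m*n≤m*m+n*n m n = [ ordered , swapped ]′ (≤-total m n)
  where
  square-of-sum : ∀ a c → 2 * (a * (a + c)) + c * c ≡ a * a + (a + c) * (a + c)
  square-of-sum = solve 2 (λ a c → con 2 :* (a :* (a :+ c)) :+ c :* c := a :* a :+ (a :+ c) :* (a :+ c)) refl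

  ordered : ∀ {a b} → a ≤ b → 2 * (a * b) ≤ a * a + b * b
  ordered {a} {b} a≤b = subst (λ b → 2 * (a * b) ≤ a * a + b * b) (m+[n∸m]≡n a≤b)
    (≤-trans (m≤m+n _ _) (≤-reflexive (square-of-sum a (b ∸ a))))

  swapped : n ≤ m → 2 * (m * n) ≤ m * m + n * n
  swapped n≤m = subst₂ _≤_ (cong (2 *_) (*-comm n m)) (+-comm (n * n) (m * m)) (ordered n≤m)

sum*sum≤n*sum-squares : ∀ n (w : Fin n → ℕ) → sum w * sum w ≤ n * ∑[ i < n ] (w i * w i)
sum*sum≤n*sum-squares n w = *-cancelˡ-≤ 2 (begin
  2 * (sum w * sum w)                                  ≡⟨ cong (2 *_) (sum*sum≡∑∑* w w) ⟩
  2 * ∑[ i < n ] ∑[ j < n ] (w i * w j)                ≡⟨ *-distribˡ-∑∑ 2 (λ i j → w i * w j) ⟩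
  ∑[ i < n ] ∑[ j < n ] (2 * (w i * w j))              ≤⟨ ∑-mono-≤ (λ i → ∑-mono-≤ (λ j → 2*m*n≤m*m+n*n (w i) (w j))) ⟩
  ∑[ i < n ] ∑[ j < n ] (w i * w i + w j * w j)        ≡⟨ ∑∑-distrib-+ (λ i _ → w i * w i) (λ _ j → w j * w j) ⟩
  ∑[ i < n ] ∑[ j < n ] (w i * w i) + ∑[ i < n ] Q     ≡⟨ cong₂ _+_ (sum-cong-≗ {n} (λ i → ∑-const n (w i * w i))) (∑-const n Q) ⟩
  ∑[ i < n ] (n * (w i * w i)) + n * Q                 ≡⟨ cong (_+ n * Q) (sym (*-distribˡ-sum n (λ i → w i * w i))) ⟩
  n * Q + n * Q                                        ≡⟨ cong (n * Q +_) (sym (+-identityʳ (n * Q))) ⟩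
  2 * (n * Q)                                          ∎)
  where
  open ≤-Reasoning
  Q : ℕ
  Q = ∑[ i < n ] (w i * w i)

lower+upper≤ : ∀ a b x → (if a <ᵇ b then x else 0) + (if b <ᵇ a then x else 0) ≤ x
lower+upper≤ a b x with a <ᵇ b in a<b | b <ᵇ a in b<a
... | true  | true  = contradiction (<ᵇ⇒< b a (subst T (sym b<a) _)) (<⇒≯ (<ᵇ⇒< a b (subst T (sym a<b) _)))
... | true  | false = ≤-reflexive (+-identityʳ x)
... | false | true  = ≤-refl
... | false | false = z≤n

∑-pairs : ∀ n → (Fin n → Fin n → ℕ) → ℕ
∑-pairs n g = ∑[ u < n ] ∑[ v < n ] (if toℕ u <ᵇ toℕ v then g u v else 0)

∑-pairs-mono-≤ : ∀ {n} {g h : Fin n → Fin n → ℕ} → (∀ u v → g u v ≤ h u v) → ∑-pairs n g ≤ ∑-pairs n h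
∑-pairs-mono-≤ g≤h = ∑-mono-≤ (λ u → ∑-mono-≤ (λ v → if-mono (toℕ u <ᵇ toℕ v) (g≤h u v)))
  where
  if-mono : ∀ b {x y} → x ≤ y → (if b then x else 0) ≤ (if b then y else 0)
  if-mono true  x≤y = x≤y
  if-mono false x≤y = z≤n

2*∑-pairs≤∑∑ : ∀ {n} (g : Fin n → Fin n → ℕ) → (∀ u v → g u v ≡ g v u) →
  2 * ∑-pairs n g ≤ ∑[ u < n ] ∑[ v < n ] g u v
2*∑-pairs≤∑∑ {n} g g-sym = begin
  2 * lower           ≡⟨ cong (lower +_) (+-identityʳ lower) ⟩
  lower + lower       ≡⟨ cong (lower +_) lower≡upper ⟩
  lower + ∑[ u < n ] ∑[ v < n ] upper-part u v
    ≡⟨ sym (∑∑-distrib-+ lower-part upper-part) ⟩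
  ∑[ u < n ] ∑[ v < n ] (lower-part u v + upper-part u v)
    ≤⟨ ∑-mono-≤ (λ u → ∑-mono-≤ (λ v → lower+upper≤ (toℕ u) (toℕ v) (g u v))) ⟩
  ∑[ u < n ] ∑[ v < n ] g u v ∎
  where
  open ≤-Reasoning
  lower-part upper-part : Fin n → Fin n → ℕ
  lower-part u v = if toℕ u <ᵇ toℕ v then g u v else 0
  upper-part u v = if toℕ v <ᵇ toℕ u then g u v else 0
  lower : ℕ
  lower = ∑-pairs n g
  lower≡upper : lower ≡ ∑[ u < n ] ∑[ v < n ] upper-part u v
  lower≡upper = trans (∑-comm lower-part)
    (sum-cong-≗ {n} (λ u → sum-cong-≗ {n} (λ v → cong (if toℕ v <ᵇ toℕ u then_else 0) (g-sym v u))))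

module Fibres {m k} (f : Fin m → Fin k) (d : Fin m → ℕ) where

  weight : Fin k → ℕ
  weight x = ∑[ u < m ] (δ (f u) x * d u)

  collision separation : Fin m → Fin m → ℕ
  collision  u v = δ (f u) (f v) * (d u * d v)
  separation u v = 𝟙 (not (does (f u ≟ f v))) * (d u * d v)

  separation-sym : ∀ u v → separation u v ≡ separation v u
  separation-sym u v = cong₂ (λ b p → 𝟙 (not b) * p) (does-≟-sym (f u) (f v)) (*-comm (d u) (d v))

  ∑-weight : ∑[ x < k ] weight x ≡ sum d
  ∑-weight = trans (∑-comm (λ x u → δ (f u) x * d u)) (sum-cong-≗ {m} (λ u → ∑-δ (f u) (λ _ → d u)))

  ∑-weight² : ∑[ x < k ] (weight x * weight x) ≡ ∑[ u < m ] ∑[ v < m ] collision u v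
  ∑-weight² = begin
    ∑[ x < k ] (weight x * weight x)
      ≡⟨ sum-cong-≗ {k} (λ x → sum*sum≡∑∑* (term x) (term x)) ⟩
    ∑[ x < k ] ∑[ u < m ] ∑[ v < m ] (term x u * term x v)
      ≡⟨ ∑-comm (λ x u → ∑[ v < m ] (term x u * term x v)) ⟩
    ∑[ u < m ] ∑[ x < k ] ∑[ v < m ] (term x u * term x v)
      ≡⟨ sum-cong-≗ {m} (λ u → ∑-comm (λ x v → term x u * term x v)) ⟩
    ∑[ u < m ] ∑[ v < m ] ∑[ x < k ] (term x u * term x v)
      ≡⟨ sum-cong-≗ {m} (λ u → sum-cong-≗ {m} (λ v → fibre-sum u v)) ⟩
    ∑[ u < m ] ∑[ v < m ] collision u v ∎
    where
    open ≡-Reasoning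
    term : Fin k → Fin m → ℕ
    term x u = δ (f u) x * d u
    regroup : ∀ a b p q → (a * p) * (b * q) ≡ a * (b * (p * q))
    regroup = solve 4 (λ a b p q → (a :* p) :* (b :* q) := a :* (b :* (p :* q))) refl
    fibre-sum : ∀ u v → ∑[ x < k ] (term x u * term x v) ≡ collision u v
    fibre-sum u v = begin
      ∑[ x < k ] (term x u * term x v)                      ≡⟨ sum-cong-≗ {k} (λ x → regroup (δ (f u) x) (δ (f v) x) (d u) (d v)) ⟩
      ∑[ x < k ] (δ (f u) x * (δ (f v) x * (d u * d v)))    ≡⟨ ∑-δ (f u) (λ x → δ (f v) x * (d u * d v)) ⟩
      δ (f v) (f u) * (d u * d v)                           ≡⟨ cong (_* (d u * d v)) (δ-sym (f v) (f u)) ⟩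
      collision u v                                         ∎

  ∑∑-collision+∑∑-separation : ∑[ u < m ] ∑[ v < m ] collision u v + ∑[ u < m ] ∑[ v < m ] separation u v ≡ sum d * sum d
  ∑∑-collision+∑∑-separation = begin
    ∑[ u < m ] ∑[ v < m ] collision u v + ∑[ u < m ] ∑[ v < m ] separation u v
      ≡⟨ sym (∑∑-distrib-+ collision separation) ⟩
    ∑[ u < m ] ∑[ v < m ] (collision u v + separation u v)
      ≡⟨ sum-cong-≗ {m} (λ u → sum-cong-≗ {m} (λ v → split (does (f u ≟ f v)) (d u * d v))) ⟩
    ∑[ u < m ] ∑[ v < m ] (d u * d v)
      ≡⟨ sym (sum*sum≡∑∑* d d) ⟩
    sum d * sum d ∎
    where
    open ≡-Reasoning
    split : ∀ b p → 𝟙 b * p + 𝟙 (not b) * p ≡ p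
    split b p = trans (sym (*-distribʳ-+ p (𝟙 b) (𝟙 (not b)))) (trans (cong (_* p) (𝟙+𝟙-not b)) (*-identityˡ p))

  k*∑∑-separation≤ : k * ∑[ u < m ] ∑[ v < m ] separation u v ≤ sum d * sum d * (k ∸ 1)
  k*∑∑-separation≤ = begin
    k * K                  ≤⟨ m+n≤o⇒m≤o∸n (k * K) k*K+S²≤k*S² ⟩
    k * S² ∸ S²            ≡⟨ cong₂ _∸_ (*-comm k S²) (sym (*-identityʳ S²)) ⟩
    S² * k ∸ S² * 1        ≡⟨ sym (*-distribˡ-∸ S² k 1) ⟩
    S² * (k ∸ 1)           ∎
    where
    open ≤-Reasoning
    S² A K : ℕ
    S² = sum d * sum d
    A = ∑[ u < m ] ∑[ v < m ] collision u v
    K = ∑[ u < m ] ∑[ v < m ] separation u v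
    S²≤k*A : S² ≤ k * A
    S²≤k*A = subst₂ (λ s q → s * s ≤ k * q) ∑-weight ∑-weight² (sum*sum≤n*sum-squares k weight)
    k*K+S²≤k*S² : k * K + S² ≤ k * S²
    k*K+S²≤k*S² = begin
      k * K + S²             ≤⟨ +-monoʳ-≤ (k * K) S²≤k*A ⟩
      k * K + k * A          ≡⟨ sym (*-distribˡ-+ k K A) ⟩
      k * (K + A)            ≡⟨ cong (k *_) (trans (+-comm K A) ∑∑-collision+∑∑-separation) ⟩
      k * S²                 ∎

sum-tabulate : ∀ {n} (g : Fin n → ℕ) → List.sum (tabulate g) ≡ sum g
sum-tabulate {zero}  g = refl
sum-tabulate {suc n} g = cong (g zero +_) (sum-tabulate (g ∘ suc))

Σv≡∑ : (G : Graph) (g : V G → ℕ) → Σv G g ≡ ∑[ u < n G ] g u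
Σv≡∑ G g = trans (cong List.sum (map-tabulate (λ u → u) g)) (sum-tabulate g)

ΣPairs≡∑-pairs : (G : Graph) (g : V G → V G → ℕ) → ΣPairs G g ≡ ∑-pairs (n G) g
ΣPairs≡∑-pairs G g = trans (Σv≡∑ G _) (sum-cong-≗ {n G} (λ u → Σv≡∑ G _))

∈⇒≤foldr-⊔ : ∀ {A : Set} (g : A → ℕ) {x : A} {xs : List A} → x ∈ xs → g x ≤ foldr _⊔_ 0 (map g xs)
∈⇒≤foldr-⊔ g {xs = y ∷ ys} (here refl) = m≤m⊔n (g y) _
∈⇒≤foldr-⊔ g {xs = y ∷ ys} (there x∈ys) = ≤-trans (∈⇒≤foldr-⊔ g x∈ys) (m≤n⊔m (g y) _)

dist≤diam : (H : Graph) (x y : V H) → dist H x y ≤ diam H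
dist≤diam H x y = ≤-trans (∈⇒≤foldr-⊔ (dist H x) (∈-allFin y))
  (∈⇒≤foldr-⊔ (λ u → foldr _⊔_ 0 (map (dist H u) (allFin (n H)))) (∈-allFin x))

dist-refl : (H : Graph) (x : V H) → dist H x x ≡ 0
dist-refl H x = firstReach-refl (n H)
  where
  firstReach-refl : ∀ fuel → firstReach H x x 0 fuel ≡ 0
  firstReach-refl zero    = refl
  firstReach-refl (suc _) rewrite trans (isYes≗does (x ≟ x)) (dec-true (x ≟ x) refl) = refl

dist²-bound : (H : Graph) (x y : V H) (p : ℕ) →
  dist H x y ^ 2 * p ≤ diam H ^ 2 * (𝟙 (not (does (x ≟ y))) * p)
dist²-bound H x y p with x ≟ y
... | yes refl rewrite dist-refl H x = z≤n
... | no _     = subst (dist H x y ^ 2 * p ≤_) (cong (diam H ^ 2 *_) (sym (+-identityʳ p)))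
                   (*-monoˡ-≤ p (^-monoˡ-≤ 2 (dist≤diam H x y)))

theorem3p3 : (G H : Graph) → Connected G → Connected H →
    (f : V G → V H) → NonConstant f →
    2 * n H * ΣPairs G (λ u v → dist H (f u) (f v) ^ 2 * deg G u * deg G v)
      ≤ vol G ^ 2 * diam H ^ 2 * (n H ∸ 1)
theorem3p3 G H _ _ f _ = begin
  2 * k * ΣPairs G energy                          ≡⟨ cong (2 * k *_) (ΣPairs≡∑-pairs G energy) ⟩
  2 * k * ∑-pairs m energy                         ≡⟨ xy∙z≈y∙xz 2 k (∑-pairs m energy) ⟩
  k * (2 * ∑-pairs m energy)                       ≤⟨ *-monoʳ-≤ k (*-monoʳ-≤ 2 (∑-pairs-mono-≤ energy≤)) ⟩
  k * (2 * ∑-pairs m (λ u v → D² * separation u v)) ≤⟨ *-monoʳ-≤ k (2*∑-pairs≤∑∑ _ (λ u v → cong (D² *_) (separation-sym u v))) ⟩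
  k * ∑[ u < m ] ∑[ v < m ] (D² * separation u v)  ≡⟨ cong (k *_) (sym (*-distribˡ-∑∑ D² separation)) ⟩
  k * (D² * K)                                     ≡⟨ x∙yz≈y∙xz k D² K ⟩
  D² * (k * K)                                     ≤⟨ *-monoʳ-≤ D² k*∑∑-separation≤ ⟩
  D² * (S * S * (k ∸ 1))                           ≡⟨ rearrange D² S (k ∸ 1) ⟩
  S ^ 2 * D² * (k ∸ 1)                             ≡⟨ cong (λ s → s ^ 2 * D² * (k ∸ 1)) (sym (Σv≡∑ G (deg G))) ⟩
  vol G ^ 2 * D² * (k ∸ 1)                         ∎
  where
  open ≤-Reasoning
  open Fibres f (deg G)
  m k D² S K : ℕ
  m = n G
  k = n H
  D² = diam H ^ 2
  S = sum (deg G)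
  K = ∑[ u < m ] ∑[ v < m ] separation u v
  energy : V G → V G → ℕ
  energy u v = dist H (f u) (f v) ^ 2 * deg G u * deg G v
  energy≤ : ∀ u v → energy u v ≤ D² * separation u v
  energy≤ u v = subst (_≤ D² * separation u v) (sym (*-assoc (dist H (f u) (f v) ^ 2) (deg G u) (deg G v)))
    (dist²-bound H (f u) (f v) (deg G u * deg G v))
  rearrange : ∀ a s t → a * (s * s * t) ≡ s ^ 2 * a * t
  rearrange = solve 3 (λ a s t → a :* (s :* s :* t) := (s :* (s :* con 1)) :* a :* t) refl
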